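{- Let $G$ be a finite abelian group of even order $n$ and let $\mathcal{B}=(B_1,\dots,B_t)$, $t\geq 2$, be an independent tuple of largest sum-free sets of $G$. Then every atom $\mathcal{B}(\boldsymbol{\varepsilon})$, $\boldsymbol{\varepsilon}\in\{0,1\}^t$, has size $n/2^t$, and a set $B\subseteq\bigcup_{i=1}^t B_i$ is a largest sum-free set of $G$ if and only if there is a largest sum-free set $S$ of the additive group $\mathbb{F}_2^t$ such that $B=\bigcup_{\boldsymbol{\varepsilon}\in S}\mathcal{B}(\boldsymbol{\varepsilon})$ (identifying $\{0,1\}^t$ with $\mathbb{F}_2^t$).
   Context: A subset of an abelian group is sum-free if it contains no (not necessarily distinct) elements $a,b,c$ with $a+b=c$; a largest sum-free set is a sum-free subset of maximum size. For a largest sum-free set $B$ write $B^1=B$, $B^0=G\setminus B$; for $\mathcal{B}=(B_1,\dots,B_t)$ and $\boldsymbol{\varepsilon}\in\{0,1\}^t$ the atom is $\mathcal{B}(\boldsymbol{\varepsilon})=\bigcap_{i=1}^t B_i^{\varepsilon_i}$. The tuple is independent if no $B_i$ is contained in the union of the remaining $B_j$'s. -}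

module Defs where

open import Data.Bool using (Bool; true; false; T; not; _∧_; _xor_; if_then_else_)
open import Data.Nat using (ℕ; zero; suc; _+_; _≤_)
open import Data.List using (List; []; _∷_; [_]; map; _++_)
open import Data.Vec using (Vec; []; _∷_; zipWith)
open import Data.Product using (_×_)
open import Relation.Nullary using (¬_)

Sub : Set → Set
Sub A = A → Bool

-- Number of elements of the list `enum` lying in S.  When `enum` lists every
-- element of a finite type exactly once, this is the cardinality |S|.
size : {A : Set} → List A → Sub A → ℕ
size []       S = 0
size (a ∷ as) S = (if S a then 1 else 0) + size as S

SumFree : {A : Set} → (A → A → A) → Sub A → Set
SumFree _⊕_ S = ∀ a b → T (S a) → T (S b) → ¬ T (S (a ⊕ b))

LargestSumFree : {A : Set} → (A → A → A) → List A → Sub A → Set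
LargestSumFree _⊕_ enum S =
  SumFree _⊕_ S × (∀ S′ → SumFree _⊕_ S′ → size enum S′ ≤ size enum S)

_⊕₂_ : ∀ {t} → Vec Bool t → Vec Bool t → Vec Bool t
_⊕₂_ = zipWith _xor_

allVecs : ∀ t → List (Vec Bool t)
allVecs zero    = [ [] ]
allVecs (suc t) = map (false ∷_) (allVecs t) ++ map (true ∷_) (allVecs t)

pow : {A : Set} → Sub A → Bool → Sub A
pow B true  x = B x
pow B false x = not (B x)

atom : {A : Set} → ∀ {t} → Vec (Sub A) t → Vec Bool t → Sub A
atom []       []       x = true
atom (B ∷ Bs) (e ∷ es) x = pow B e x ∧ atom Bs es x

-- A sum-free set S containing a is disjoint from its translate S - a, so 2|S| ≤ |G|, with
-- equality exactly when S is the complement of an index-2 subgroup, i.e. when its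
-- characteristic function is a nonzero homomorphism G → 𝔽₂.  When |G| is even such a
-- homomorphism exists (2G is a proper subgroup, and a maximal proper subgroup above it has
-- index 2), so every largest sum-free set is one.  Hence χ = (B₁, …, B_t) : G → 𝔽₂^t is a
-- homomorphism; independence says it hits every unit vector, so it is onto and its fibres,
-- the atoms, are cosets of its kernel of size n/2^t.  A largest sum-free B′ ⊆ ⋃ Bᵢ is a
-- homomorphism vanishing on ker χ, hence B′ = S ∘ χ for a nonzero homomorphism S on 𝔽₂^t,
-- i.e. a largest sum-free set of 𝔽₂^t; the converse is the same computation read backwards.

module Submission where

open import Defs
open import Algebra.Bundles using (AbelianGroup)
open import Algebra.Structures using (IsAbelianGroup)
open import Data.Bool using (Bool; true; false; T; not; _∧_; _∨_; _xor_; if_then_else_)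
open import Data.Bool.Properties
  using (T?; T-≡; T-not-≡; T-∧; T-∨; xor-assoc; xor-comm; xor-same; true-xor)
open import Data.Empty using (⊥-elim)
open import Data.Fin using (Fin; zero; suc; toℕ; _≟_)
import Data.Fin.Properties as Fin
open import Data.Fin.Properties using (toℕ-injective; toℕ<n; any?; all?; ¬∀⟶∃¬; injective⇒≤)
open import Data.Fin.Permutation using (permutation)
open import Data.List using (List; []; _∷_; length; map; _++_; allFin; tabulate)
open import Data.List.Membership.Propositional using (_∈_)
open import Data.List.Membership.Propositional.Properties using (∈-++⁺ˡ; ∈-++⁺ʳ; ∈-map⁺; ∈-allFin)
open import Data.List.Properties using (length-tabulate)
open import Data.List.Relation.Unary.Any using (here; there)
open import Data.Nat using (ℕ; zero; suc; _+_; _*_; _^_; _≤_; _<_; z≤n; s≤s; _<ᵇ_; _≡ᵇ_)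
open import Data.Nat.Divisibility using (_∣_)
open import Data.Nat.Properties hiding (_≟_)
open import Data.Nat.Tactic.RingSolver using (solve-∀)
open import Data.Product using (Σ; _×_; _,_; ∃-syntax; proj₁; proj₂)
open import Data.Sum using (_⊎_; inj₁; inj₂)
open import Data.Vec using (Vec; []; _∷_; lookup; replicate)
import Data.Vec as Vec
open import Data.Vec.Properties using (∷-injectiveˡ; ∷-injectiveʳ; lookup-map)
open import Function using (id; _∘_)
open import Function.Bundles using (_⇔_; mk⇔; Equivalence)
open import Level using (0ℓ)
open import Relation.Binary.PropositionalEquality
open import Relation.Nullary using (¬_; yes; no)
open import Relation.Nullary.Decidable using (⌊_⌋; toWitness; fromWitness; _×-dec_; _→-dec_; ¬?)

import Algebra.Properties.AbelianGroup as AbelianGroupProperties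
import Algebra.Properties.CommutativeMonoid.Sum as MonoidSum
import Algebra.Properties.CommutativeSemigroup as CommutativeSemigroupProperties

open CommutativeSemigroupProperties +-commutativeSemigroup using () renaming (interchange to +-interchange)

𝟙 : Bool → ℕ
𝟙 b = if b then 1 else 0

T⇒≡true : ∀ {b} → T b → b ≡ true
T⇒≡true = Equivalence.to T-≡

¬T⇒≡false : ∀ {b} → ¬ T b → b ≡ false
¬T⇒≡false {false} _ = refl
¬T⇒≡false {true}  ¬b = ⊥-elim (¬b _)

≡true⇒T : ∀ {b} → b ≡ true → T b
≡true⇒T = Equivalence.from T-≡

≡false⇒¬T : ∀ {b} → b ≡ false → ¬ T b
≡false⇒¬T = subst T

T-not : ∀ {b} → ¬ T b → T (not b)
T-not {b} ¬b = Equivalence.from T-not-≡ (¬T⇒≡false ¬b)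

T⇔T⇒≡ : ∀ {a b} → (T a → T b) → (T b → T a) → a ≡ b
T⇔T⇒≡ {true}  {true}  _ _ = refl
T⇔T⇒≡ {false} {false} _ _ = refl
T⇔T⇒≡ {true}  {false} f _ = ⊥-elim (f _)
T⇔T⇒≡ {false} {true}  _ g = ⊥-elim (g _)

xor≡false⇒≡ : ∀ a b → a xor b ≡ false → a ≡ b
xor≡false⇒≡ true  true  _ = refl
xor≡false⇒≡ false false _ = refl

≡⇒xor≡false : ∀ a b → a ≡ b → a xor b ≡ false
≡⇒xor≡false a _ refl = xor-same a

𝟙-mono : ∀ {b c} → (T b → T c) → 𝟙 b ≤ 𝟙 c
𝟙-mono {false}         _ = z≤n
𝟙-mono {true}  {true}  _ = s≤s z≤n
𝟙-mono {true}  {false} f = ⊥-elim (f _)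

[k+k]*p≡k*[2*p] : ∀ k p → (k + k) * p ≡ k * (2 * p)
[k+k]*p≡k*[2*p] = solve-∀

m+m≤n+n⇒m≤n : ∀ m n → m + m ≤ n + n → m ≤ n
m+m≤n+n⇒m≤n m n m+m≤n+n with m ≤? n
... | yes m≤n = m≤n
... | no  m≰n = ⊥-elim (<⇒≱ (+-mono-< (≰⇒> m≰n) (≰⇒> m≰n)) m+m≤n+n)

∈⇒length>0 : ∀ {A : Set} {x : A} {L} → x ∈ L → 0 < length L
∈⇒length>0 {L = _ ∷ _} _ = s≤s z≤n

module _ {A : Set} where

  size-+ : ∀ (L : List A) (P Q R : Sub A) → (∀ x → 𝟙 (P x) + 𝟙 (Q x) ≡ 𝟙 (R x))
         → size L P + size L Q ≡ size L R
  size-+ []      P Q R pointwise = refl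
  size-+ (a ∷ L) P Q R pointwise = begin
    (𝟙 (P a) + size L P) + (𝟙 (Q a) + size L Q) ≡⟨ +-interchange (𝟙 (P a)) _ _ _ ⟩
    (𝟙 (P a) + 𝟙 (Q a)) + (size L P + size L Q) ≡⟨ cong₂ _+_ (pointwise a) (size-+ L P Q R pointwise) ⟩
    𝟙 (R a) + size L R                          ∎
    where open ≡-Reasoning

  size-cong : ∀ (L : List A) {S U : Sub A} → (∀ x → S x ≡ U x) → size L S ≡ size L U
  size-cong []      S≡U = refl
  size-cong (a ∷ L) S≡U = cong₂ _+_ (cong 𝟙 (S≡U a)) (size-cong L S≡U)

  size-mono : ∀ (L : List A) {S U : Sub A} → (∀ x → T (S x) → T (U x)) → size L S ≤ size L U
  size-mono []      S⊆U = z≤n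
  size-mono (a ∷ L) S⊆U = +-mono-≤ (𝟙-mono (S⊆U a)) (size-mono L S⊆U)

  size-< : ∀ (L : List A) {S U : Sub A} → (∀ x → T (S x) → T (U x))
         → ∀ {x} → x ∈ L → T (U x) → ¬ T (S x) → size L S < size L U
  size-< (a ∷ L) {S} {U} S⊆U (here refl) Ux ¬Sx
    rewrite ¬T⇒≡false ¬Sx | T⇒≡true Ux = s≤s (size-mono L S⊆U)
  size-< (a ∷ L) {S} {U} S⊆U (there x∈L) Ux ¬Sx =
    subst (_≤ 𝟙 (U a) + size L U) (+-suc (𝟙 (S a)) (size L S))
      (+-mono-≤ (𝟙-mono (S⊆U a)) (size-< L S⊆U x∈L Ux ¬Sx))

  size≡0⊎nonempty : ∀ (L : List A) (S : Sub A) → size L S ≡ 0 ⊎ ∃[ x ] T (S x)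
  size≡0⊎nonempty []      S = inj₁ refl
  size≡0⊎nonempty (a ∷ L) S with S a in Sa
  ... | true  = inj₂ (a , ≡true⇒T Sa)
  ... | false = size≡0⊎nonempty L S

  size-const : ∀ (L : List A) b → size L (λ _ → b) ≡ length L * 𝟙 b
  size-const []      b = refl
  size-const (_ ∷ L) b = cong (𝟙 b +_) (size-const L b)

  size-empty : ∀ (L : List A) → size L (λ _ → false) ≡ 0
  size-empty L = trans (size-const L false) (*-zeroʳ (length L))

  size-full : ∀ (L : List A) → size L (λ _ → true) ≡ length L
  size-full L = trans (size-const L true) (*-identityʳ (length L))

  size-complement : ∀ (L : List A) (S : Sub A) → size L S + size L (not ∘ S) ≡ length L
  size-complement L S = trans (size-+ L S (not ∘ S) (λ _ → true) (λ x → partition (S x))) (size-full L)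
    where
      partition : ∀ b → 𝟙 b + 𝟙 (not b) ≡ 1
      partition true  = refl
      partition false = refl

  size-++ : ∀ (L M : List A) S → size (L ++ M) S ≡ size L S + size M S
  size-++ []      M S = refl
  size-++ (a ∷ L) M S = trans (cong (𝟙 (S a) +_) (size-++ L M S)) (sym (+-assoc (𝟙 (S a)) _ _))

size-map : ∀ {A B : Set} (f : A → B) (L : List A) S → size (map f L) S ≡ size L (S ∘ f)
size-map f []      S = refl
size-map f (a ∷ L) S = cong (𝟙 (S (f a)) +_) (size-map f L S)

IsHom𝔽₂ : {A : Set} → (A → A → A) → Sub A → Set
IsHom𝔽₂ _∙_ χ = ∀ x y → χ (x ∙ y) ≡ χ x xor χ y

NonzeroHom𝔽₂ : {A : Set} → (A → A → A) → Set
NonzeroHom𝔽₂ {A} _∙_ = Σ (Sub A) λ χ → IsHom𝔽₂ _∙_ χ × ∃[ a ] T (χ a)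

module Hom𝔽₂ {A : Set} (_∙_ : A → A → A) (e : A) (inv : A → A)
             (isAbelianGroup : IsAbelianGroup _≡_ _∙_ e inv) (χ : Sub A) (hom : IsHom𝔽₂ _∙_ χ) where

  open IsAbelianGroup isAbelianGroup using (identityʳ; inverseʳ)

  hom-e : χ e ≡ false
  hom-e = trans (cong χ (sym (identityʳ e))) (trans (hom e e) (xor-same (χ e)))

  hom-inv : ∀ x → χ (inv x) ≡ χ x
  hom-inv x = sym (xor≡false⇒≡ (χ x) (χ (inv x)) (trans (sym (hom x (inv x))) (trans (cong χ (inverseʳ x)) hom-e)))

  hom-// : ∀ x y → χ (x ∙ inv y) ≡ χ x xor χ y
  hom-// x y = trans (hom x (inv y)) (cong (χ x xor_) (hom-inv y))

module SumFreeSets {A : Set} (_∙_ : A → A → A) (e : A) (inv : A → A)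
                   (isAbelianGroup : IsAbelianGroup _≡_ _∙_ e inv)
                   (enum : List A) (enum-complete : ∀ x → x ∈ enum)
                   (size-translate : ∀ (S : Sub A) a → size enum (λ x → S (x ∙ a)) ≡ size enum S)
                   where

  open IsAbelianGroup isAbelianGroup using (assoc; comm)
  private
    abelianGroup : AbelianGroup 0ℓ 0ℓ
    abelianGroup = record { isAbelianGroup = isAbelianGroup }

  open AbelianGroupProperties abelianGroup using (//-rightDividesˡ; xyx⁻¹≈y)

  ∣_∣ : Sub A → ℕ
  ∣_∣ = size enum

  N : ℕ
  N = length enum

  //-∙-cancel : ∀ x a y → (x ∙ inv a) ∙ (a ∙ y) ≡ x ∙ y
  //-∙-cancel x a y = trans (sym (assoc (x ∙ inv a) a y)) (cong (_∙ y) (//-rightDividesˡ a x))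

  translate-disjoint : ∀ S → SumFree _∙_ S → ∀ a → T (S a) → ∀ x → T (S (x ∙ inv a)) → T (not (S x))
  translate-disjoint S sumFree a Sa x Sx-a with S x in Sx
  ... | false = _
  ... | true  = sumFree (x ∙ inv a) a Sx-a Sa (subst (T ∘ S) (sym (//-rightDividesˡ a x)) (≡true⇒T Sx))

  sumFree-size-bound : ∀ S → SumFree _∙_ S → ∣ S ∣ + ∣ S ∣ ≤ N
  sumFree-size-bound S sumFree with size≡0⊎nonempty enum S
  ... | inj₁ ∣S∣≡0     = subst (λ k → k + k ≤ N) (sym ∣S∣≡0) z≤n
  ... | inj₂ (a , Sa) = begin
    ∣ S ∣ + ∣ S ∣                         ≡⟨ cong (∣ S ∣ +_) (size-translate S (inv a)) ⟨
    ∣ S ∣ + ∣ (λ x → S (x ∙ inv a)) ∣      ≤⟨ +-monoʳ-≤ ∣ S ∣ (size-mono enum (translate-disjoint S sumFree a Sa)) ⟩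
    ∣ S ∣ + ∣ not ∘ S ∣                   ≡⟨ size-complement enum S ⟩
    N                                     ∎
    where open ≤-Reasoning

  module _ (S : Sub A) (sumFree : SumFree _∙_ S) (large : N ≤ ∣ S ∣ + ∣ S ∣) where

    translate-complement : ∀ a → T (S a) → ∀ x → ¬ T (S x) → T (S (x ∙ inv a))
    translate-complement a Sa x ¬Sx with S (x ∙ inv a) in Sx-a
    ... | true  = _
    ... | false = ⊥-elim (<⇒≱ translate<complement complement≤translate)
      where
        translate<complement : ∣ (λ y → S (y ∙ inv a)) ∣ < ∣ not ∘ S ∣
        translate<complement = size-< enum (translate-disjoint S sumFree a Sa) (enum-complete x)
                                 (T-not ¬Sx) (≡false⇒¬T Sx-a)
        complement≤translate : ∣ not ∘ S ∣ ≤ ∣ (λ y → S (y ∙ inv a)) ∣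
        complement≤translate = subst (∣ not ∘ S ∣ ≤_) (sym (size-translate S (inv a)))
          (+-cancelˡ-≤ ∣ S ∣ _ _ (subst (_≤ ∣ S ∣ + ∣ S ∣) (sym (size-complement enum S)) large))

    in∙out∈ : ∀ x y → T (S x) → ¬ T (S y) → T (S (x ∙ y))
    in∙out∈ x y Sx ¬Sy with S (x ∙ y) in Sxy
    ... | true  = _
    ... | false = ⊥-elim (¬Sy (subst (T ∘ S) (xyx⁻¹≈y x y) (translate-complement x Sx (x ∙ y) (≡false⇒¬T Sxy))))

    large-nonempty : A → ∃[ a ] T (S a)
    large-nonempty x with size≡0⊎nonempty enum S
    ... | inj₁ ∣S∣≡0  = ⊥-elim (<⇒≱ (∈⇒length>0 (enum-complete x)) (subst (λ k → N ≤ k + k) ∣S∣≡0 large))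
    ... | inj₂ S∋a = S∋a

    sumFree-large⇒hom : IsHom𝔽₂ _∙_ S
    sumFree-large⇒hom x y with S x in Sx | S y in Sy
    ... | true  | true  = ¬T⇒≡false (sumFree x y (≡true⇒T Sx) (≡true⇒T Sy))
    ... | true  | false = T⇒≡true (in∙out∈ x y (≡true⇒T Sx) (≡false⇒¬T Sy))
    ... | false | true  = T⇒≡true (subst (T ∘ S) (comm y x) (in∙out∈ y x (≡true⇒T Sy) (≡false⇒¬T Sx)))
    ... | false | false with large-nonempty x
    ... | a , Sa = ¬T⇒≡false λ Sxy → sumFree (x ∙ inv a) (a ∙ y) Sx-a Sa+y
                     (subst (T ∘ S) (sym (//-∙-cancel x a y)) Sxy)
      where
        Sx-a = translate-complement a Sa x (≡false⇒¬T Sx)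
        Sa+y = in∙out∈ a y Sa (≡false⇒¬T Sy)

  hom⇒sumFree : ∀ χ → IsHom𝔽₂ _∙_ χ → SumFree _∙_ χ
  hom⇒sumFree χ hom x y χx χy χxy =
    subst T (trans (hom x y) (cong₂ _xor_ (T⇒≡true χx) (T⇒≡true χy))) χxy

  nonzeroHom-size : ((χ , _) : NonzeroHom𝔽₂ _∙_) → ∣ χ ∣ + ∣ χ ∣ ≡ N
  nonzeroHom-size (χ , hom , a , χa) = begin
    ∣ χ ∣ + ∣ χ ∣                    ≡⟨ cong (∣ χ ∣ +_) (size-translate χ a) ⟨
    ∣ χ ∣ + ∣ (λ x → χ (x ∙ a)) ∣    ≡⟨ cong (∣ χ ∣ +_) (size-cong enum χx+a≡¬χx) ⟩
    ∣ χ ∣ + ∣ not ∘ χ ∣              ≡⟨ size-complement enum χ ⟩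
    N                                ∎
    where
      open ≡-Reasoning
      χx+a≡¬χx : ∀ x → χ (x ∙ a) ≡ not (χ x)
      χx+a≡¬χx x = begin
        χ (x ∙ a)       ≡⟨ hom x a ⟩
        χ x xor χ a     ≡⟨ cong (χ x xor_) (T⇒≡true χa) ⟩
        χ x xor true    ≡⟨ xor-comm (χ x) true ⟩
        true xor χ x    ≡⟨ true-xor (χ x) ⟩
        not (χ x)       ∎

  nonzeroHom⇒largestSumFree : ((χ , _) : NonzeroHom𝔽₂ _∙_) → LargestSumFree _∙_ enum χ
  nonzeroHom⇒largestSumFree χ⁺@(χ , hom , _) =
    hom⇒sumFree χ hom , λ S sumFree →
      m+m≤n+n⇒m≤n _ _ (subst (∣ S ∣ + ∣ S ∣ ≤_) (sym (nonzeroHom-size χ⁺)) (sumFree-size-bound S sumFree))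

  largestSumFree⇒nonzeroHom : NonzeroHom𝔽₂ _∙_ → ∀ S → LargestSumFree _∙_ enum S
                            → IsHom𝔽₂ _∙_ S × ∃[ a ] T (S a)
  largestSumFree⇒nonzeroHom η⁺@(η , hom , a , _) S (sumFree , largest) =
    sumFree-large⇒hom S sumFree large , large-nonempty S sumFree large a
    where
      η≤S = largest η (hom⇒sumFree η hom)
      large : N ≤ ∣ S ∣ + ∣ S ∣
      large = subst (_≤ ∣ S ∣ + ∣ S ∣) (nonzeroHom-size η⁺) (+-mono-≤ η≤S η≤S)

0ᵥ : ∀ {t} → Vec Bool t
0ᵥ = replicate _ false

⊕₂-assoc : ∀ {t} (x y z : Vec Bool t) → (x ⊕₂ y) ⊕₂ z ≡ x ⊕₂ (y ⊕₂ z)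
⊕₂-assoc []      []      []      = refl
⊕₂-assoc (a ∷ x) (b ∷ y) (c ∷ z) = cong₂ _∷_ (xor-assoc a b c) (⊕₂-assoc x y z)

⊕₂-comm : ∀ {t} (x y : Vec Bool t) → x ⊕₂ y ≡ y ⊕₂ x
⊕₂-comm []      []      = refl
⊕₂-comm (a ∷ x) (b ∷ y) = cong₂ _∷_ (xor-comm a b) (⊕₂-comm x y)

⊕₂-identityˡ : ∀ {t} (x : Vec Bool t) → 0ᵥ ⊕₂ x ≡ x
⊕₂-identityˡ []      = refl
⊕₂-identityˡ (a ∷ x) = cong (a ∷_) (⊕₂-identityˡ x)

⊕₂-identityʳ : ∀ {t} (x : Vec Bool t) → x ⊕₂ 0ᵥ ≡ x
⊕₂-identityʳ x = trans (⊕₂-comm x 0ᵥ) (⊕₂-identityˡ x)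

⊕₂-self : ∀ {t} (x : Vec Bool t) → x ⊕₂ x ≡ 0ᵥ
⊕₂-self []      = refl
⊕₂-self (a ∷ x) = cong₂ _∷_ (xor-same a) (⊕₂-self x)

⊕₂-self-cancel : ∀ {t} (x z : Vec Bool t) → (x ⊕₂ z) ⊕₂ z ≡ x
⊕₂-self-cancel x z = begin
  (x ⊕₂ z) ⊕₂ z   ≡⟨ ⊕₂-assoc x z z ⟩
  x ⊕₂ (z ⊕₂ z)   ≡⟨ cong (x ⊕₂_) (⊕₂-self z) ⟩
  x ⊕₂ 0ᵥ         ≡⟨ ⊕₂-identityʳ x ⟩
  x               ∎
  where open ≡-Reasoning

⊕₂-cancelʳ : ∀ {t} (x y z : Vec Bool t) → x ⊕₂ z ≡ y ⊕₂ z → x ≡ y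
⊕₂-cancelʳ x y z x⊕z≡y⊕z = trans (sym (⊕₂-self-cancel x z)) (trans (cong (_⊕₂ z) x⊕z≡y⊕z) (⊕₂-self-cancel y z))

⊕₂-isAbelianGroup : ∀ {t} → IsAbelianGroup _≡_ (_⊕₂_ {t}) 0ᵥ id
⊕₂-isAbelianGroup = record
  { isGroup = record
    { isMonoid = record
      { isSemigroup = record
        { isMagma = record { isEquivalence = isEquivalence ; ∙-cong = cong₂ _⊕₂_ }
        ; assoc = ⊕₂-assoc }
      ; identity = ⊕₂-identityˡ , ⊕₂-identityʳ }
    ; inverse = ⊕₂-self , ⊕₂-self
    ; ⁻¹-cong = id }
  ; comm = ⊕₂-comm }

size-allVecs : ∀ t (S : Sub (Vec Bool (suc t)))
             → size (allVecs (suc t)) S ≡ size (allVecs t) (S ∘ (false ∷_)) + size (allVecs t) (S ∘ (true ∷_))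
size-allVecs t S = trans (size-++ (map (false ∷_) (allVecs t)) _ S)
  (cong₂ _+_ (size-map (false ∷_) (allVecs t) S) (size-map (true ∷_) (allVecs t) S))

allVecs-complete : ∀ t (x : Vec Bool t) → x ∈ allVecs t
allVecs-complete zero    []          = here refl
allVecs-complete (suc t) (false ∷ x) = ∈-++⁺ˡ (∈-map⁺ (false ∷_) (allVecs-complete t x))
allVecs-complete (suc t) (true ∷ x)  =
  ∈-++⁺ʳ (map (false ∷_) (allVecs t)) (∈-map⁺ (true ∷_) (allVecs-complete t x))

size-allVecs-translate : ∀ t (S : Sub (Vec Bool t)) a
                       → size (allVecs t) (λ x → S (x ⊕₂ a)) ≡ size (allVecs t) S
size-allVecs-translate zero    S []          = refl
size-allVecs-translate (suc t) S (false ∷ a) = begin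
  size (allVecs (suc t)) (λ x → S (x ⊕₂ (false ∷ a)))   ≡⟨ size-allVecs t _ ⟩
  ∣ (λ x → S (false ∷ x ⊕₂ a)) ∣ + ∣ (λ x → S (true ∷ x ⊕₂ a)) ∣
    ≡⟨ cong₂ _+_ (size-allVecs-translate t _ a) (size-allVecs-translate t _ a) ⟩
  ∣ S ∘ (false ∷_) ∣ + ∣ S ∘ (true ∷_) ∣                 ≡⟨ size-allVecs t S ⟨
  size (allVecs (suc t)) S                              ∎
  where
    open ≡-Reasoning
    ∣_∣ = size (allVecs t)
size-allVecs-translate (suc t) S (true ∷ a) = begin
  size (allVecs (suc t)) (λ x → S (x ⊕₂ (true ∷ a)))    ≡⟨ size-allVecs t _ ⟩
  ∣ (λ x → S (true ∷ x ⊕₂ a)) ∣ + ∣ (λ x → S (false ∷ x ⊕₂ a)) ∣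
    ≡⟨ cong₂ _+_ (size-allVecs-translate t _ a) (size-allVecs-translate t _ a) ⟩
  ∣ S ∘ (true ∷_) ∣ + ∣ S ∘ (false ∷_) ∣                 ≡⟨ +-comm ∣ S ∘ (true ∷_) ∣ _ ⟩
  ∣ S ∘ (false ∷_) ∣ + ∣ S ∘ (true ∷_) ∣                 ≡⟨ size-allVecs t S ⟨
  size (allVecs (suc t)) S                              ∎
  where
    open ≡-Reasoning
    ∣_∣ = size (allVecs t)

head-nonzeroHom : ∀ {t} → 1 ≤ t → NonzeroHom𝔽₂ (_⊕₂_ {t})
head-nonzeroHom {suc t} _ = Vec.head , (λ { (a ∷ _) (b ∷ _) → refl }) , (true ∷ 0ᵥ) , _

unit : ∀ {t} → Fin t → Vec Bool t
unit zero    = true ∷ 0ᵥ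
unit (suc i) = false ∷ unit i

units-span : ∀ t (P : Vec Bool t → Set) → P 0ᵥ → (∀ x y → P x → P y → P (x ⊕₂ y))
           → (∀ i → P (unit i)) → ∀ x → P x
units-span zero    P P0 P⊕ Punit []      = P0
units-span (suc t) P P0 P⊕ Punit (b ∷ x) = P-∷ b x
  where
    P-false∷ : ∀ x → P (false ∷ x)
    P-false∷ = units-span t (P ∘ (false ∷_)) P0 (λ x y → P⊕ (false ∷ x) (false ∷ y)) (Punit ∘ suc)
    P-∷ : ∀ b x → P (b ∷ x)
    P-∷ false x = P-false∷ x
    P-∷ true  x = subst (λ y → P (true ∷ y)) (⊕₂-identityˡ x) (P⊕ _ _ (Punit zero) (P-false∷ x))

open MonoidSum +-0-commutativeMonoid using (sum; sum-permute)

size-tabulate : ∀ {n} {B : Set} (f : Fin n → B) (S : Sub B) → size (tabulate f) S ≡ sum (𝟙 ∘ S ∘ f)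
size-tabulate {zero}  f S = refl
size-tabulate {suc n} f S = cong (𝟙 (S (f zero)) +_) (size-tabulate (f ∘ suc) S)

size-allFin-suc : ∀ n (S : Sub (Fin (suc n))) → size (allFin (suc n)) S ≡ 𝟙 (S zero) + size (allFin n) (S ∘ suc)
size-allFin-suc n S = cong (𝟙 (S zero) +_) (trans (size-tabulate suc S) (sym (size-tabulate id (S ∘ suc))))

size-allFin-permute : ∀ n (π : Fin n → Fin n) (π⁻¹ : Fin n → Fin n)
                    → (∀ x → π (π⁻¹ x) ≡ x) → (∀ x → π⁻¹ (π x) ≡ x)
                    → (S : Sub (Fin n)) → size (allFin n) (S ∘ π) ≡ size (allFin n) S
size-allFin-permute n π π⁻¹ ππ⁻¹ π⁻¹π S = begin
  size (allFin n) (S ∘ π)  ≡⟨ size-tabulate id (S ∘ π) ⟩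
  sum (𝟙 ∘ S ∘ π)          ≡⟨ sum-permute (𝟙 ∘ S) (permutation π π⁻¹ ππ⁻¹ π⁻¹π) ⟨
  sum (𝟙 ∘ S)              ≡⟨ size-tabulate id S ⟨
  size (allFin n) S        ∎
  where open ≡-Reasoning

length-allFin : ∀ n → length (allFin n) ≡ n
length-allFin n = length-tabulate id

size-allFin-singleton : ∀ n k → k < n → size (allFin n) (λ x → toℕ x ≡ᵇ k) ≡ 1
size-allFin-singleton (suc n) zero    _         =
  trans (size-allFin-suc n (λ x → toℕ x ≡ᵇ 0)) (cong suc (size-empty (allFin n)))
size-allFin-singleton (suc n) (suc k) (s≤s k<n) =
  trans (size-allFin-suc n (λ x → toℕ x ≡ᵇ suc k)) (size-allFin-singleton n k k<n)

<ᵇ-trichotomy : ∀ m n → 𝟙 (m <ᵇ n) + 𝟙 (n <ᵇ m) ≡ 𝟙 (not (m ≡ᵇ n))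
<ᵇ-trichotomy zero    zero    = refl
<ᵇ-trichotomy zero    (suc n) = refl
<ᵇ-trichotomy (suc m) zero    = refl
<ᵇ-trichotomy (suc m) (suc n) = <ᵇ-trichotomy m n

module FiniteAbelianGroup (n : ℕ) (_∙_ : Fin n → Fin n → Fin n) (e : Fin n) (inv : Fin n → Fin n)
                          (isAbelianGroup : IsAbelianGroup _≡_ _∙_ e inv) where

  open IsAbelianGroup isAbelianGroup using (assoc; comm; inverseʳ; identityʳ)
  private
    abelianGroup : AbelianGroup 0ℓ 0ℓ
    abelianGroup = record { isAbelianGroup = isAbelianGroup }

  open AbelianGroupProperties abelianGroup
    using (//-rightDividesˡ; //-rightDividesʳ; xyx⁻¹≈y; ⁻¹-involutive; ε⁻¹≈ε; ⁻¹-∙-comm)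
  open CommutativeSemigroupProperties (AbelianGroup.commutativeSemigroup abelianGroup) using (interchange)

  size-translate : ∀ (S : Sub (Fin n)) a → size (allFin n) (λ x → S (x ∙ a)) ≡ size (allFin n) S
  size-translate S a =
    size-allFin-permute n (_∙ a) (_∙ inv a) (λ x → //-rightDividesˡ a x) (λ x → //-rightDividesʳ a x) S

  open SumFreeSets _∙_ e inv isAbelianGroup (allFin n) ∈-allFin size-translate public

  -- Negation pairs x with inv x; comparing their indices splits the elements that are
  -- not self-inverse into two halves of equal size.
  below above selfInverse : Sub (Fin n)
  below       x = toℕ x <ᵇ toℕ (inv x)
  above       x = toℕ (inv x) <ᵇ toℕ x
  selfInverse x = toℕ x ≡ᵇ toℕ (inv x)

  size-above : ∣ above ∣ ≡ ∣ below ∣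
  size-above = begin
    ∣ above ∣          ≡⟨ size-cong (allFin n) (λ x → cong (λ y → toℕ (inv x) <ᵇ toℕ y) (⁻¹-involutive x)) ⟨
    ∣ below ∘ inv ∣    ≡⟨ size-allFin-permute n inv inv ⁻¹-involutive ⁻¹-involutive below ⟩
    ∣ below ∣          ∎
    where open ≡-Reasoning

  size-selfInverse : ∣ selfInverse ∣ + 2 * ∣ below ∣ ≡ n
  size-selfInverse = begin
    ∣ selfInverse ∣ + 2 * ∣ below ∣              ≡⟨ cong (λ k → ∣ selfInverse ∣ + (∣ below ∣ + k)) (+-identityʳ _) ⟩
    ∣ selfInverse ∣ + (∣ below ∣ + ∣ below ∣)    ≡⟨ cong (λ k → ∣ selfInverse ∣ + (∣ below ∣ + k)) size-above ⟨
    ∣ selfInverse ∣ + (∣ below ∣ + ∣ above ∣)    ≡⟨ cong (∣ selfInverse ∣ +_) below+above ⟩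
    ∣ selfInverse ∣ + ∣ not ∘ selfInverse ∣       ≡⟨ size-complement (allFin n) selfInverse ⟩
    length (allFin n)                            ≡⟨ length-allFin n ⟩
    n                                            ∎
    where
      open ≡-Reasoning
      below+above = size-+ (allFin n) below above (not ∘ selfInverse) (λ x → <ᵇ-trichotomy (toℕ x) (toℕ (inv x)))

  even⇒∃order2 : 2 ∣ n → ∃[ g ] (g ≢ e × g ∙ g ≡ e)
  even⇒∃order2 2∣n with any? (λ g → ¬? (g ≟ e) ×-dec (g ∙ g ≟ e))
  ... | yes order2 = order2
  ... | no ¬order2 = ⊥-elim (even≢odd quotient ∣ below ∣ 2q≡1+2b)
    where
      open _∣_ 2∣n using (quotient; equality)
      selfInverse⇒e : ∀ x → x ≡ inv x → x ≡ e
      selfInverse⇒e x x≡x⁻¹ with x ≟ e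
      ... | yes x≡e = x≡e
      ... | no  x≢e = ⊥-elim (¬order2 (x , x≢e , trans (cong (x ∙_) x≡x⁻¹) (inverseʳ x)))
      selfInverse≡e : ∀ x → selfInverse x ≡ (toℕ x ≡ᵇ toℕ e)
      selfInverse≡e x = T⇔T⇒≡ to from
        where
          to : T (selfInverse x) → T (toℕ x ≡ᵇ toℕ e)
          to sx = ≡⇒≡ᵇ (toℕ x) (toℕ e)
            (cong toℕ (selfInverse⇒e x (toℕ-injective (≡ᵇ⇒≡ (toℕ x) (toℕ (inv x)) sx))))
          from : T (toℕ x ≡ᵇ toℕ e) → T (selfInverse x)
          from x≡ᵇe with toℕ-injective (≡ᵇ⇒≡ (toℕ x) (toℕ e) x≡ᵇe)
          ... | refl = ≡⇒≡ᵇ (toℕ e) (toℕ (inv e)) (cong toℕ (sym ε⁻¹≈ε))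
      size-selfInverse≡1 : ∣ selfInverse ∣ ≡ 1
      size-selfInverse≡1 = trans (size-cong (allFin n) selfInverse≡e) (size-allFin-singleton n (toℕ e) (toℕ<n e))
      2q≡1+2b : 2 * quotient ≡ suc (2 * ∣ below ∣)
      2q≡1+2b = begin
        2 * quotient                       ≡⟨ *-comm 2 quotient ⟩
        quotient * 2                       ≡⟨ equality ⟨
        n                                  ≡⟨ size-selfInverse ⟨
        ∣ selfInverse ∣ + 2 * ∣ below ∣    ≡⟨ cong (_+ 2 * ∣ below ∣) size-selfInverse≡1 ⟩
        suc (2 * ∣ below ∣)                ∎
        where open ≡-Reasoning

  -- A section of a surjective doubling map is injective and misses some square root of e,
  -- so it extends to an injection Fin (suc n) → Fin n.
  even⇒doubling-not-surjective : 2 ∣ n → ∃[ x ] (∀ y → y ∙ y ≢ x)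
  even⇒doubling-not-surjective 2∣n with all? (λ x → any? (λ y → y ∙ y ≟ x))
  ... | no ¬surjective with ¬∀⟶∃¬ n _ (λ x → any? (λ y → y ∙ y ≟ x)) ¬surjective
  ...   | x , ¬∃y = x , λ y 2y≡x → ¬∃y (y , 2y≡x)
  even⇒doubling-not-surjective 2∣n | yes surjective =
    ⊥-elim (<⇒≱ ≤-refl (injective⇒≤ {f = extend} extend-injective))
    where
      half : Fin n → Fin n
      half x = proj₁ (surjective x)
      half-double : ∀ x → half x ∙ half x ≡ x
      half-double x = proj₂ (surjective x)
      half-injective : ∀ {x y} → half x ≡ half y → x ≡ y
      half-injective {x} {y} hx≡hy =
        trans (sym (half-double x)) (trans (cong (λ z → z ∙ z) hx≡hy) (half-double y))
      root-avoiding-half : ∃[ m ] (m ∙ m ≡ e × half e ≢ m)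
      root-avoiding-half with half e ≟ e | even⇒∃order2 2∣n
      ... | yes h≡e | g , g≢e , g∙g≡e = g , g∙g≡e , λ h≡g → g≢e (trans (sym h≡g) h≡e)
      ... | no  h≢e | _               = e , identityʳ e , h≢e
      m = proj₁ root-avoiding-half
      m∉half : ∀ x → m ≢ half x
      m∉half x m≡hx = proj₂ (proj₂ root-avoiding-half) (trans (cong half (sym x≡e)) (sym m≡hx))
        where
          x≡e : x ≡ e
          x≡e = trans (sym (half-double x)) (trans (cong (λ z → z ∙ z) (sym m≡hx)) (proj₁ (proj₂ root-avoiding-half)))
      extend : Fin (suc n) → Fin n
      extend zero    = m
      extend (suc x) = half x
      extend-injective : ∀ {i j} → extend i ≡ extend j → i ≡ j
      extend-injective {zero}  {zero}  _ = refl
      extend-injective {zero}  {suc j} m≡hj = ⊥-elim (m∉half j m≡hj)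
      extend-injective {suc i} {zero}  hi≡m = ⊥-elim (m∉half i (sym hi≡m))
      extend-injective {suc i} {suc j} hi≡hj = cong suc (half-injective hi≡hj)

  missing⇒size<n : ∀ S z → ¬ T (S z) → ∣ S ∣ < n
  missing⇒size<n S z ¬Sz = subst (∣ S ∣ <_) (trans (size-full (allFin n)) (length-allFin n))
    (size-< (allFin n) (λ _ _ → _) (∈-allFin z) _ ¬Sz)

  //-∙-comm : ∀ x g y → (x ∙ inv g) ∙ y ≡ (x ∙ y) ∙ inv g
  //-∙-comm x g y = trans (assoc x (inv g) y) (trans (cong (x ∙_) (comm (inv g) y)) (sym (assoc x y (inv g))))

  //∙//∙double : ∀ x y g → ((x ∙ inv g) ∙ (y ∙ inv g)) ∙ (g ∙ g) ≡ x ∙ y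
  //∙//∙double x y g =
    trans (interchange (x ∙ inv g) (y ∙ inv g) g g) (cong₂ _∙_ (//-rightDividesˡ g x) (//-rightDividesˡ g y))

  //∙double : ∀ x g → (x ∙ inv g) ∙ (g ∙ g) ≡ x ∙ g
  //∙double x g = trans (sym (assoc (x ∙ inv g) g g)) (cong (_∙ g) (//-rightDividesˡ g x))

  inv-//∙inv-double : ∀ x g → inv (x ∙ inv g) ∙ inv (g ∙ g) ≡ inv x ∙ inv g
  inv-//∙inv-double x g = begin
    inv (x ∙ inv g) ∙ inv (g ∙ g)    ≡⟨ ⁻¹-∙-comm (x ∙ inv g) (g ∙ g) ⟩
    inv ((x ∙ inv g) ∙ (g ∙ g))      ≡⟨ cong inv (//∙double x g) ⟩
    inv (x ∙ g)                      ≡⟨ ⁻¹-∙-comm x g ⟨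
    inv x ∙ inv g                    ∎
    where open ≡-Reasoning

  record ProperSubgroupOverDoubles (M : Sub (Fin n)) : Set where
    field
      ∙-closed   : ∀ x y → T (M x) → T (M y) → T (M (x ∙ y))
      inv-closed : ∀ x → T (M x) → T (M (inv x))
      doubles    : ∀ x → T (M (x ∙ x))
      proper     : ∃[ z ] ¬ T (M z)

    e-closed : T (M e)
    e-closed = subst (T ∘ M) (identityʳ e) (doubles e)

  adjoin : ∀ {M} → ProperSubgroupOverDoubles M → ∀ g y → ¬ T (M g) → ¬ T (M y) → ¬ T (M (y ∙ inv g))
         → Σ (Sub (Fin n)) λ M′ → ProperSubgroupOverDoubles M′ × ∣ M ∣ < ∣ M′ ∣
  adjoin {M} subgroup g y ¬Mg ¬My ¬My-g = M′ , subgroup′ , size-< (allFin n) inj₁′ (∈-allFin g) M′g ¬Mg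
    where
      open ProperSubgroupOverDoubles subgroup
      M′ : Sub (Fin n)
      M′ x = M x ∨ M (x ∙ inv g)
      inj₁′ : ∀ x → T (M x) → T (M′ x)
      inj₁′ x = Equivalence.from T-∨ ∘ inj₁
      inj₂′ : ∀ x → T (M (x ∙ inv g)) → T (M′ x)
      inj₂′ x = Equivalence.from T-∨ ∘ inj₂
      M′g : T (M′ g)
      M′g = inj₂′ g (subst (T ∘ M) (sym (inverseʳ g)) e-closed)
      ∙-closed′ : ∀ x y → T (M′ x) → T (M′ y) → T (M′ (x ∙ y))
      ∙-closed′ x y M′x M′y with Equivalence.to T-∨ M′x | Equivalence.to T-∨ M′y
      ... | inj₁ Mx   | inj₁ My   = inj₁′ _ (∙-closed x y Mx My)
      ... | inj₁ Mx   | inj₂ My-g = inj₂′ _ (subst (T ∘ M) (sym (assoc x y (inv g))) (∙-closed _ _ Mx My-g))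
      ... | inj₂ Mx-g | inj₁ My   = inj₂′ _ (subst (T ∘ M) (//-∙-comm x g y) (∙-closed _ _ Mx-g My))
      ... | inj₂ Mx-g | inj₂ My-g = inj₁′ _ (subst (T ∘ M) (//∙//∙double x y g)
                                      (∙-closed _ _ (∙-closed _ _ Mx-g My-g) (doubles g)))
      inv-closed′ : ∀ x → T (M′ x) → T (M′ (inv x))
      inv-closed′ x M′x with Equivalence.to T-∨ M′x
      ... | inj₁ Mx   = inj₁′ _ (inv-closed x Mx)
      ... | inj₂ Mx-g = inj₂′ _ (subst (T ∘ M) (inv-//∙inv-double x g)
                          (∙-closed _ _ (inv-closed _ Mx-g) (inv-closed _ (doubles g))))
      ¬M′y : ¬ T (M′ y)
      ¬M′y M′y with Equivalence.to T-∨ M′y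
      ... | inj₁ My   = ¬My My
      ... | inj₂ My-g = ¬My-g My-g
      subgroup′ : ProperSubgroupOverDoubles M′
      subgroup′ = record
        { ∙-closed = ∙-closed′ ; inv-closed = inv-closed′ ; doubles = λ x → inj₁′ _ (doubles x) ; proper = y , ¬M′y }

  maximal⇒nonzeroHom : ∀ {M} → ProperSubgroupOverDoubles M
                     → (∀ g → ¬ T (M g) → ∀ y → T (M y) ⊎ T (M (y ∙ inv g)))
                     → NonzeroHom𝔽₂ _∙_
  maximal⇒nonzeroHom {M} subgroup maximal = not ∘ M , hom , proj₁ proper , T-not (proj₂ proper)
    where
      open ProperSubgroupOverDoubles subgroup
      in∙out∉ : ∀ x y → T (M x) → ¬ T (M y) → ¬ T (M (x ∙ y))
      in∙out∉ x y Mx ¬My Mxy = ¬My (subst (T ∘ M) (xyx⁻¹≈y x y) (∙-closed _ _ Mxy (inv-closed x Mx)))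
      out∙out∈ : ∀ x y → ¬ T (M x) → ¬ T (M y) → T (M (x ∙ y))
      out∙out∈ x y ¬Mx ¬My with maximal x ¬Mx y
      ... | inj₁ My   = ⊥-elim (¬My My)
      ... | inj₂ My-x = subst (T ∘ M) (trans (//∙double y x) (comm y x)) (∙-closed _ _ My-x (doubles x))
      hom : IsHom𝔽₂ _∙_ (not ∘ M)
      hom x y with M x in Mx | M y in My
      ... | true  | true  = cong not (T⇒≡true (∙-closed x y (≡true⇒T Mx) (≡true⇒T My)))
      ... | true  | false = cong not (¬T⇒≡false (in∙out∉ x y (≡true⇒T Mx) (≡false⇒¬T My)))
      ... | false | true  = cong not (¬T⇒≡false (subst (¬_ ∘ T ∘ M) (comm y x) (in∙out∉ y x (≡true⇒T My) (≡false⇒¬T Mx))))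
      ... | false | false = cong not (T⇒≡true (out∙out∈ x y (≡false⇒¬T Mx) (≡false⇒¬T My)))

  -- The fuel k bounds the number of strict enlargements of M that are still possible.
  grow : ∀ k {M} → ProperSubgroupOverDoubles M → n ≤ ∣ M ∣ + k → NonzeroHom𝔽₂ _∙_
  grow zero {M} subgroup n≤∣M∣+0 =
    ⊥-elim (<⇒≱ (missing⇒size<n M _ (proj₂ proper)) (subst (n ≤_) (+-identityʳ ∣ M ∣) n≤∣M∣+0))
    where open ProperSubgroupOverDoubles subgroup using (proper)
  grow (suc k) {M} subgroup n≤∣M∣+1+k
    with any? (λ g → ¬? (T? (M g)) ×-dec any? (λ y → ¬? (T? (M y)) ×-dec ¬? (T? (M (y ∙ inv g)))))
  ... | yes (g , ¬Mg , y , ¬My , ¬My-g) with adjoin subgroup g y ¬Mg ¬My ¬My-g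
  ...   | M′ , subgroup′ , ∣M∣<∣M′∣ =
    grow k subgroup′ (≤-trans n≤∣M∣+1+k (subst (_≤ ∣ M′ ∣ + k) (sym (+-suc ∣ M ∣ k)) (+-monoˡ-≤ k ∣M∣<∣M′∣)))
  grow (suc k) {M} subgroup _ | no ¬extendable = maximal⇒nonzeroHom subgroup maximal
    where
      maximal : ∀ g → ¬ T (M g) → ∀ y → T (M y) ⊎ T (M (y ∙ inv g))
      maximal g ¬Mg y with T? (M y) | T? (M (y ∙ inv g))
      ... | yes My | _         = inj₁ My
      ... | no _   | yes My-g  = inj₂ My-g
      ... | no ¬My | no ¬My-g = ⊥-elim (¬extendable (g , ¬Mg , y , ¬My , ¬My-g))

  isDouble : Sub (Fin n)
  isDouble x = ⌊ any? (λ y → y ∙ y ≟ x) ⌋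

  doubles-properSubgroup : 2 ∣ n → ProperSubgroupOverDoubles isDouble
  doubles-properSubgroup 2∣n = record
    { ∙-closed   = λ x y 2G∋x 2G∋y →
        let (u , u∙u≡x) = toWitness 2G∋x ; (v , v∙v≡y) = toWitness 2G∋y in
        fromWitness (u ∙ v , trans (interchange u v u v) (cong₂ _∙_ u∙u≡x v∙v≡y))
    ; inv-closed = λ x 2G∋x →
        let (u , u∙u≡x) = toWitness 2G∋x in
        fromWitness (inv u , trans (⁻¹-∙-comm u u) (cong inv u∙u≡x))
    ; doubles    = λ x → fromWitness (x , refl)
    ; proper     = let (z , z∉2G) = even⇒doubling-not-surjective 2∣n in
        z , λ 2G∋z → let (u , u∙u≡z) = toWitness 2G∋z in z∉2G u u∙u≡z
    }

  even⇒nonzeroHom : 2 ∣ n → NonzeroHom𝔽₂ _∙_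
  even⇒nonzeroHom 2∣n = grow n (doubles-properSubgroup 2∣n) (m≤n+m n ∣ isDouble ∣)

module Atoms {A : Set} where

  coords : ∀ {m} → Vec (Sub A) m → A → Vec Bool m
  coords Bs x = Vec.map (λ b → b x) Bs

  T-pow : ∀ (b : Sub A) e x → T (pow b e x) ⇔ b x ≡ e
  T-pow b true  x = T-≡
  T-pow b false x = T-not-≡

  T-atom : ∀ {m} (Bs : Vec (Sub A) m) ε x → T (atom Bs ε x) ⇔ coords Bs x ≡ ε
  T-atom []       []       x = mk⇔ (λ _ → refl) (λ _ → _)
  T-atom (b ∷ Bs) (e ∷ es) x = mk⇔
    (λ b∧atom → let (pow-b , atom-Bs) = Equivalence.to T-∧ b∧atom in
       cong₂ _∷_ (Equivalence.to (T-pow b e x) pow-b) (Equivalence.to (T-atom Bs es x) atom-Bs))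
    (λ coords≡ → Equivalence.from T-∧
       ( Equivalence.from (T-pow b e x) (∷-injectiveˡ coords≡)
       , Equivalence.from (T-atom Bs es x) (∷-injectiveʳ coords≡)))

  size-atoms : ∀ (L : List A) {m} (Bs : Vec (Sub A) m) k
             → (∀ ε → size L (atom Bs ε) ≡ k) → length L ≡ k * 2 ^ m
  size-atoms L []       k atoms≡k = trans (sym (size-full L)) (trans (atoms≡k []) (sym (*-identityʳ k)))
  size-atoms L (b ∷ Bs) k atoms≡k = begin
    length L        ≡⟨ size-atoms L Bs (k + k) split ⟩
    (k + k) * 2 ^ m ≡⟨ [k+k]*p≡k*[2*p] k (2 ^ m) ⟩
    k * 2 ^ suc m   ∎
    where
      open ≡-Reasoning
      m = Vec.length Bs
      partition : ∀ a c → 𝟙 (not a ∧ c) + 𝟙 (a ∧ c) ≡ 𝟙 c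
      partition true  c = refl
      partition false c = +-identityʳ (𝟙 c)
      split : ∀ ε → size L (atom Bs ε) ≡ k + k
      split ε = trans (sym (size-+ L _ _ (atom Bs ε) (λ x → partition (b x) (atom Bs ε x))))
                      (cong₂ _+_ (atoms≡k (false ∷ ε)) (atoms≡k (true ∷ ε)))

  coords-hom : ∀ (_∙_ : A → A → A) {m} (Bs : Vec (Sub A) m) → (∀ i → IsHom𝔽₂ _∙_ (lookup Bs i))
             → ∀ x y → coords Bs (x ∙ y) ≡ coords Bs x ⊕₂ coords Bs y
  coords-hom _∙_ []       hom x y = refl
  coords-hom _∙_ (b ∷ Bs) hom x y = cong₂ _∷_ (hom zero x y) (coords-hom _∙_ Bs (hom ∘ suc) x y)

  coords-outside : ∀ {m} (Bs : Vec (Sub A) m) x → (∀ j → ¬ T (lookup Bs j x)) → coords Bs x ≡ 0ᵥ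
  coords-outside []       x outside = refl
  coords-outside (b ∷ Bs) x outside = cong₂ _∷_ (¬T⇒≡false (outside zero)) (coords-outside Bs x (outside ∘ suc))

  coords-unit : ∀ {m} (Bs : Vec (Sub A) m) i x → T (lookup Bs i x) → (∀ j → j ≢ i → ¬ T (lookup Bs j x))
              → coords Bs x ≡ unit i
  coords-unit (b ∷ Bs) zero    x inside only = cong₂ _∷_ (T⇒≡true inside) (coords-outside Bs x (λ j → only (suc j) λ ()))
  coords-unit (b ∷ Bs) (suc i) x inside only =
    cong₂ _∷_ (¬T⇒≡false (only zero λ ())) (coords-unit Bs i x inside (λ j j≢i → only (suc j) (j≢i ∘ Fin.suc-injective)))

module IndependentLargestSumFreeSets
  (n : ℕ) (_∙_ : Fin n → Fin n → Fin n) (e : Fin n) (inv : Fin n → Fin n)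
  (isAbelianGroup : IsAbelianGroup _≡_ _∙_ e inv) (2∣n : 2 ∣ n)
  {t : ℕ} (B : Vec (Sub (Fin n)) t)
  (largest : ∀ i → LargestSumFree _∙_ (allFin n) (lookup B i))
  (independent : ∀ i → ¬ (∀ x → T (lookup B i x) → ∃[ j ] (j ≢ i × T (lookup B j x))))
  where

  open FiniteAbelianGroup n _∙_ e inv isAbelianGroup
  open Hom𝔽₂ _∙_ e inv isAbelianGroup using (hom-e; hom-//)
  open Atoms
  module SumFreeIn𝔽₂^t = SumFreeSets (_⊕₂_ {t}) 0ᵥ id ⊕₂-isAbelianGroup (allVecs t) (allVecs-complete t)
                            (size-allVecs-translate t)

  B-hom : ∀ i → IsHom𝔽₂ _∙_ (lookup B i)
  B-hom i = proj₁ (largestSumFree⇒nonzeroHom (even⇒nonzeroHom 2∣n) (lookup B i) (largest i))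

  χ : Fin n → Vec Bool t
  χ = coords B

  χ-hom : ∀ x y → χ (x ∙ y) ≡ χ x ⊕₂ χ y
  χ-hom = coords-hom _∙_ B B-hom

  χ-e : χ e ≡ 0ᵥ
  χ-e = coords-outside B e (λ i → ≡false⇒¬T (hom-e (lookup B i) (B-hom i)))

  exclusive-element : ∀ i → ∃[ x ] (T (lookup B i x) × ∀ j → j ≢ i → ¬ T (lookup B j x))
  exclusive-element i with ¬∀⟶∃¬ n _ (λ x → T? (lookup B i x) →-dec any? (λ j → ¬? (j ≟ i) ×-dec T? (lookup B j x)))
                                 (independent i)
  ... | x , ¬shared = x , inside , λ j j≢i Bjx → ¬shared (λ _ → j , j≢i , Bjx)
    where
      inside : T (lookup B i x)
      inside with T? (lookup B i x)
      ... | yes Bix = Bix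
      ... | no ¬Bix = ⊥-elim (¬shared (⊥-elim ∘ ¬Bix))

  χ-surjective : ∀ ε → ∃[ x ] (χ x ≡ ε)
  χ-surjective = units-span t (λ ε → ∃[ x ] (χ x ≡ ε)) (e , χ-e)
    (λ _ _ (x , χx≡u) (y , χy≡v) → x ∙ y , trans (χ-hom x y) (cong₂ _⊕₂_ χx≡u χy≡v))
    (λ i → let (x , Bix , only) = exclusive-element i in x , coords-unit B i x Bix only)

  atom-translate : ∀ ε c → χ c ≡ ε → ∀ x → atom B ε (x ∙ c) ≡ atom B 0ᵥ x
  atom-translate ε c χc≡ε x = T⇔T⇒≡
    (λ in-ε → Equivalence.from (T-atom B 0ᵥ x) (⊕₂-cancelʳ (χ x) 0ᵥ ε
       (trans (sym χ[x∙c]≡χx⊕ε) (trans (Equivalence.to (T-atom B ε (x ∙ c)) in-ε) (sym (⊕₂-identityˡ ε))))))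
    (λ in-0 → Equivalence.from (T-atom B ε (x ∙ c))
       (trans χ[x∙c]≡χx⊕ε (trans (cong (_⊕₂ ε) (Equivalence.to (T-atom B 0ᵥ x) in-0)) (⊕₂-identityˡ ε))))
    where
      χ[x∙c]≡χx⊕ε : χ (x ∙ c) ≡ χ x ⊕₂ ε
      χ[x∙c]≡χx⊕ε = trans (χ-hom x c) (cong (χ x ⊕₂_) χc≡ε)

  size-atom : ∀ ε → ∣ atom B ε ∣ ≡ ∣ atom B 0ᵥ ∣
  size-atom ε = let (c , χc≡ε) = χ-surjective ε in
    trans (sym (size-translate (atom B ε) c)) (size-cong (allFin n) (atom-translate ε c χc≡ε))

  size-atom*2^t : ∀ ε → ∣ atom B ε ∣ * 2 ^ t ≡ n
  size-atom*2^t ε = begin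
    ∣ atom B ε ∣ * 2 ^ t     ≡⟨ cong (_* 2 ^ t) (size-atom ε) ⟩
    ∣ atom B 0ᵥ ∣ * 2 ^ t    ≡⟨ size-atoms (allFin n) B ∣ atom B 0ᵥ ∣ size-atom ⟨
    length (allFin n)        ≡⟨ length-allFin n ⟩
    n                        ∎
    where open ≡-Reasoning

  Covered : Sub (Fin n) → Set
  Covered B′ = ∀ x → T (B′ x) → ∃[ i ] T (lookup B i x)

  UnionOfAtoms : Sub (Fin n) → Sub (Vec Bool t) → Set
  UnionOfAtoms B′ S = ∀ x → T (B′ x) ⇔ (∃[ ε ] (T (S ε) × T (atom B ε x)))

  section : Vec Bool t → Fin n
  section ε = proj₁ (χ-surjective ε)

  χ∘section : ∀ ε → χ (section ε) ≡ ε
  χ∘section ε = proj₂ (χ-surjective ε)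

  same-χ⇒uncovered : ∀ {x y} → χ x ≡ χ y → ∀ i → ¬ T (lookup B i (x ∙ inv y))
  same-χ⇒uncovered {x} {y} χx≡χy i = ≡false⇒¬T (begin
    lookup B i (x ∙ inv y)               ≡⟨ hom-// (lookup B i) (B-hom i) x y ⟩
    lookup B i x xor lookup B i y        ≡⟨ ≡⇒xor≡false _ _ Bix≡Biy ⟩
    false                                ∎)
    where
      open ≡-Reasoning
      Bix≡Biy : lookup B i x ≡ lookup B i y
      Bix≡Biy = trans (sym (lookup-map i (λ b → b x) B)) (trans (cong (λ v → lookup v i) χx≡χy) (lookup-map i (λ b → b y) B))

  covered-hom-factors : ∀ {B′} → IsHom𝔽₂ _∙_ B′ → Covered B′ → ∀ {x y} → χ x ≡ χ y → B′ x ≡ B′ y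
  covered-hom-factors {B′} hom covered {x} {y} χx≡χy = xor≡false⇒≡ (B′ x) (B′ y) (begin
    B′ x xor B′ y        ≡⟨ hom-// B′ hom x y ⟨
    B′ (x ∙ inv y)       ≡⟨ ¬T⇒≡false uncovered ⟩
    false                ∎)
    where
      open ≡-Reasoning
      uncovered : ¬ T (B′ (x ∙ inv y))
      uncovered B′x-y = let (i , Bi) = covered _ B′x-y in same-χ⇒uncovered χx≡χy i Bi

  unionOfAtoms⇒factors : ∀ {B′ S} → UnionOfAtoms B′ S → ∀ x → B′ x ≡ S (χ x)
  unionOfAtoms⇒factors {B′} {S} union x = T⇔T⇒≡
    (λ B′x → let (ε , Sε , in-ε) = Equivalence.to (union x) B′x in
       subst (T ∘ S) (sym (Equivalence.to (T-atom B ε x) in-ε)) Sε)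
    (λ Sχx → Equivalence.from (union x) (χ x , Sχx , Equivalence.from (T-atom B (χ x) x) refl))

  largestSumFree⇒unionOfAtoms : ∀ B′ → Covered B′ → LargestSumFree _∙_ (allFin n) B′
                              → ∃[ S ] (LargestSumFree _⊕₂_ (allVecs t) S × UnionOfAtoms B′ S)
  largestSumFree⇒unionOfAtoms B′ covered largestB′ =
    S , SumFreeIn𝔽₂^t.nonzeroHom⇒largestSumFree (S , S-hom , χ a , subst T (factors a) B′a) , union
    where
      B′-nonzeroHom = largestSumFree⇒nonzeroHom (even⇒nonzeroHom 2∣n) B′ largestB′
      B′-hom = proj₁ B′-nonzeroHom
      a = proj₁ (proj₂ B′-nonzeroHom)
      B′a = proj₂ (proj₂ B′-nonzeroHom)
      S : Sub (Vec Bool t)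
      S = B′ ∘ section
      factors : ∀ x → B′ x ≡ S (χ x)
      factors x = covered-hom-factors B′-hom covered (sym (χ∘section (χ x)))
      S-hom : IsHom𝔽₂ _⊕₂_ S
      S-hom u v = begin
        S (u ⊕₂ v)                          ≡⟨ cong S (cong₂ _⊕₂_ (χ∘section u) (χ∘section v)) ⟨
        S (χ (section u) ⊕₂ χ (section v))  ≡⟨ cong S (χ-hom (section u) (section v)) ⟨
        S (χ (section u ∙ section v))       ≡⟨ factors (section u ∙ section v) ⟨
        B′ (section u ∙ section v)          ≡⟨ B′-hom (section u) (section v) ⟩
        S u xor S v                         ∎
        where open ≡-Reasoning
      union : UnionOfAtoms B′ S
      union x = mk⇔
        (λ B′x → χ x , subst T (factors x) B′x , Equivalence.from (T-atom B (χ x) x) refl)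
        (λ (ε , Sε , in-ε) → subst T (sym (trans (factors x) (cong S (Equivalence.to (T-atom B ε x) in-ε)))) Sε)

  unionOfAtoms⇒largestSumFree : 1 ≤ t → ∀ B′ → ∃[ S ] (LargestSumFree _⊕₂_ (allVecs t) S × UnionOfAtoms B′ S)
                              → LargestSumFree _∙_ (allFin n) B′
  unionOfAtoms⇒largestSumFree 1≤t B′ (S , largestS , union) =
    nonzeroHom⇒largestSumFree (B′ , B′-hom , section b , subst T (sym (trans (factors (section b)) (cong S (χ∘section b)))) Sb)
    where
      S-nonzeroHom = SumFreeIn𝔽₂^t.largestSumFree⇒nonzeroHom (head-nonzeroHom 1≤t) S largestS
      b = proj₁ (proj₂ S-nonzeroHom)
      Sb = proj₂ (proj₂ S-nonzeroHom)
      factors = unionOfAtoms⇒factors union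
      B′-hom : IsHom𝔽₂ _∙_ B′
      B′-hom x y = begin
        B′ (x ∙ y)               ≡⟨ factors (x ∙ y) ⟩
        S (χ (x ∙ y))            ≡⟨ cong S (χ-hom x y) ⟩
        S (χ x ⊕₂ χ y)           ≡⟨ proj₁ S-nonzeroHom (χ x) (χ y) ⟩
        S (χ x) xor S (χ y)      ≡⟨ cong₂ _xor_ (factors x) (factors y) ⟨
        B′ x xor B′ y            ∎
        where open ≡-Reasoning

lemma3p9 : (n : ℕ) (_+_ : Fin n → Fin n → Fin n) (0g : Fin n) (-_ : Fin n → Fin n)
           → IsAbelianGroup _≡_ _+_ 0g -_
           → 2 ∣ n
           → (t : ℕ) → 2 ≤ t
           → (B : Vec (Sub (Fin n)) t)
           → (∀ i → LargestSumFree _+_ (allFin n) (lookup B i))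
           → (∀ i → ¬ (∀ x → T (lookup B i x) → ∃[ j ] (j ≢ i × T (lookup B j x))))
           → (∀ (ε : Vec Bool t) → size (allFin n) (atom B ε) * 2 ^ t ≡ n)
             × (∀ (B′ : Sub (Fin n)) → (∀ x → T (B′ x) → ∃[ i ] T (lookup B i x))
                → (LargestSumFree _+_ (allFin n) B′
                   ⇔ (∃[ S ] (LargestSumFree _⊕₂_ (allVecs t) S
                              × (∀ x → T (B′ x) ⇔ (∃[ ε ] (T (S ε) × T (atom B ε x))))))))
lemma3p9 n _∙_ e inv isAbelianGroup 2∣n t 2≤t B largest independent =
  size-atom*2^t ,
  λ B′ covered → mk⇔ (largestSumFree⇒unionOfAtoms B′ covered) (unionOfAtoms⇒largestSumFree 1≤t B′)
  where
    open IndependentLargestSumFreeSets n _∙_ e inv isAbelianGroup 2∣n B largest independent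
    1≤t : 1 ≤ t
    1≤t = ≤-trans (s≤s z≤n) 2≤t
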